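{- Let $H$ be a graph with minimum degree $\delta(H)\ge2$. Then for all $n\ge|V(H)|$, \[\mathrm{wsat}(n,H)\ge\gamma_H^2\,(n-|V(H)|)+|E(H)|-1.\]
   Context: For a graph $H$, $\mathrm{wsat}(n,H)$ is the minimum number of edges of a graph $F$ on $n$ vertices such that the non-edges of $F$ can be ordered $e_1,\dots,e_k$ so that each $F\cup\{e_1,\dots,e_i\}$ contains a copy of $H$ containing $e_i$. For a non-empty graph $H$ without isolated vertices and integer $0\le m<|V(H)|$, \[\gamma_H^m=\min\left\{\frac{|\{e\in E(H): e\cap U\neq\emptyset\}|-1}{|U|}: \emptyset\neq U\subseteq V(H),\ |V(H)\setminus U|\ge m\right\}.\] -}

module Defs where

open import Data.Bool using (Bool; true; false; _∨_; _∧_; if_then_else_)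
open import Data.Nat as ℕ using (ℕ; zero; suc; _∸_; _<_; _≤_)
open import Data.Fin using (Fin; toℕ)
open import Data.Fin.Subset using (Subset; _∈_) renaming (∣_∣ to ∣_∣ˢ)
open import Data.List as List using (List; []; _∷_; length; filter; concatMap; allFin; take; lookup)
import Data.List.Membership.Propositional as LM
open import Data.List.Relation.Unary.Unique.Propositional using (Unique)
open import Data.Vec as Vec using (Vec)
open import Data.Product using (_×_; _,_; Σ; ∃; ∃-syntax; proj₁; proj₂)
open import Data.Sum using (_⊎_)
open import Data.Integer as ℤ using (ℤ; +_)
open import Data.Rational as ℚ using (ℚ)
open import Relation.Binary.PropositionalEquality using (_≡_)
open import Relation.Nullary using (¬_; does)
open import Relation.Nullary.Decidable using (T?)
open import Data.Fin.Subset.Properties using (_∈?_)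
open import Function.Definitions using (Injective)

record Graph (v : ℕ) : Set where
  field
    adj    : Fin v → Fin v → Bool
    sym    : ∀ i j → adj i j ≡ adj j i
    irrefl : ∀ i → adj i i ≡ false
open Graph public

count : {A : Set} → (A → Bool) → List A → ℕ
count p []       = 0
count p (x ∷ xs) = (if p x then 1 else 0) ℕ.+ count p xs

-- all unordered pairs {i , j} of Fin v, represented as (i , j) with i < j
pairs : (v : ℕ) → List (Fin v × Fin v)
pairs v = filter (λ ij → toℕ (proj₁ ij) ℕ.<? toℕ (proj₂ ij))
                 (List.cartesianProduct (allFin v) (allFin v))

edgeCount : {v : ℕ} → Graph v → ℕ
edgeCount {v} G = count (λ ij → adj G (proj₁ ij) (proj₂ ij)) (pairs v)

degree : {v : ℕ} → Graph v → Fin v → ℕ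
degree {v} G i = count (adj G i) (allFin v)

MinDegree≥ : {v : ℕ} → Graph v → ℕ → Set
MinDegree≥ G k = ∀ i → k ≤ degree G i

AdjPlus : {n : ℕ} → Graph n → List (Fin n × Fin n) → Fin n → Fin n → Set
AdjPlus F es x y = (adj F x y ≡ true) ⊎ (LM._∈_ (x , y) es ⊎ LM._∈_ (y , x) es)

CopyContaining : {v n : ℕ} → Graph v → Graph n → List (Fin n × Fin n) →
                 Fin n × Fin n → Set
CopyContaining {v} {n} H F es e =
  Σ (Fin v → Fin n) λ φ →
    Injective _≡_ _≡_ φ ×
    (∀ x y → adj H x y ≡ true → AdjPlus F es (φ x) (φ y)) ×
    (∃[ x ] ∃[ y ] (adj H x y ≡ true × φ x ≡ proj₁ e × φ y ≡ proj₂ e))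

EnumeratesNonEdges : {n : ℕ} → Graph n → List (Fin n × Fin n) → Set
EnumeratesNonEdges {n} F es =
  Unique es ×
  (∀ {e} → LM._∈_ e es → LM._∈_ e (pairs n) × adj F (proj₁ e) (proj₂ e) ≡ false) ×
  (∀ {e} → LM._∈_ e (pairs n) → adj F (proj₁ e) (proj₂ e) ≡ false → LM._∈_ e es)

WeaklySaturated : {v n : ℕ} → Graph v → Graph n → Set
WeaklySaturated H F =
  ∃[ es ] (EnumeratesNonEdges F es ×
           (∀ (k : Fin (length es)) →
              CopyContaining H F (take (suc (toℕ k)) es) (lookup es k)))

allSubsets : (v : ℕ) → List (Subset v)
allSubsets zero    = Vec.[] ∷ []
allSubsets (suc v) = concatMap (λ s → (true Vec.∷ s) ∷ (false Vec.∷ s) ∷ []) (allSubsets v)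

edgesMeeting : {v : ℕ} → Graph v → Subset v → ℕ
edgesMeeting {v} H U =
  count (λ ij → adj H (proj₁ ij) (proj₂ ij) ∧
                (does (proj₁ ij ∈? U) ∨ does (proj₂ ij ∈? U))) (pairs v)

admissible : {v : ℕ} → ℕ → Subset v → Bool
admissible {v} m U = does (1 ℕ.≤? ∣ U ∣ˢ) ∧ does (m ℕ.≤? (v ∸ ∣ U ∣ˢ))

-- (|{e : e ∩ U ≠ ∅}| - 1) / |U|   (value for |U| = 0 is irrelevant)
ratio : {v : ℕ} → Graph v → Subset v → ℚ
ratio H U with ∣ U ∣ˢ
... | zero  = ℚ.0ℚ
... | suc k = (+ edgesMeeting H U ℤ.- + 1) ℚ./ suc k

-- minimum of a list of rationals (default 0 for the empty list, which
-- never occurs in the use below)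
minList : List ℚ → ℚ
minList []       = ℚ.0ℚ
minList (x ∷ []) = x
minList (x ∷ y ∷ xs) = x ℚ.⊓ minList (y ∷ xs)

γ : {v : ℕ} → Graph v → ℕ → ℚ
γ {v} H m = minList (List.map (ratio H) (filter (λ U → T? (admissible m U)) (allSubsets v)))

{-# OPTIONS --safe #-}

-- Let γ ≥ 0 be at most every ratio in the definition of γ_H^2, and v = |V(H)|. Follow the
-- saturation process of F while keeping a cover of the current edge set by clusters: single
-- edges, of weight 1, and vertex sets X ("blobs"), of weight max(0, γ(|X| − v) + e(H) − 1). The
-- edges of F form a cover of weight e(F). When an added edge completes a copy of H, replace the
-- clusters meeting the copy in at least two vertices by one blob containing them and the copy.
-- Every edge of the copy except the new one lies inside a replaced cluster, and the definition
-- of γ, applied to the vertices of the copy outside each replaced cluster, shows that the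
-- replaced clusters weigh at least as much as the new blob. Once all pairs are covered, merging
-- along copies made of one fresh vertex and vertices of a fixed blob grows that blob to all n
-- vertices without increasing the weight, so e(F) ≥ γ(n − v) + e(H) − 1. Minimum degree 2
-- provides what this needs: γ_H^2 ≥ 0, e(H) ≥ 1 and v ≥ 3 (or v = 0).

module Submission where

open import Algebra.Bundles using (CommutativeMonoid)
import Algebra.Properties.CommutativeSemigroup as CommSemigroupProperties
open import Data.Bool using (Bool; true; false; not; _∧_; _∨_; if_then_else_; T)
open import Data.Bool.ListAction using (any)
open import Data.Bool.Properties using (∧-zeroʳ; ∧-identityʳ; ∧-distribˡ-∨; ∨-zeroʳ; T-∧; T-≡)
open import Data.Empty using (⊥)
open import Data.Fin as Fin using (Fin; zero; suc; toℕ)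
open import Data.Fin.Properties using (_≟_; toℕ-injective; toℕ-fromℕ<; inject≤-injective)
open import Data.Fin.Subset as Subset using (Subset) renaming (∣_∣ to ∣_∣ˢ)
import Data.Fin.Subset.Properties as Subset
open import Data.Integer as ℤ using (ℤ; +_)
import Data.Integer.Properties as ℤ
open import Data.List using (List; []; _∷_; length; map; filter; allFin; take; lookup; _∷ʳ_)
import Data.List.Membership.DecPropositional
open import Data.List.Membership.Propositional using (_∈_; find; lose)
open import Data.List.Membership.Propositional.Properties
  using (∈-allFin; ∈-map⁺; ∈-map⁻; ∈-filter⁺; ∈-filter⁻; ∈-cartesianProduct⁺; ∈-concatMap⁺; ∈-++⁻)
open import Data.List.Properties using (map-tabulate; length-tabulate; take-suc; take-all)
open import Data.List.Relation.Unary.All.Properties using (All¬⇒¬Any)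
import Data.List.Relation.Unary.All as All
open import Data.List.Relation.Unary.AllPairs using ([]; _∷_)
open import Data.List.Relation.Unary.Any as Any using (here; there)
open import Data.List.Relation.Unary.Any.Properties using (any⁺; any⁻)
open import Data.List.Relation.Unary.Unique.Propositional using (Unique)
import Data.List.Relation.Unary.Unique.Propositional.Properties as Unique
open import Data.Nat as ℕ using (ℕ; zero; suc; _≤_; _<_; _∸_; z≤n; s≤s)
open import Data.Nat.Coprimality as Coprime using (1-coprimeTo)
import Data.Nat.Properties as ℕ
open import Data.Product as Product using (_×_; _,_; ∃-syntax; proj₁; proj₂)
open import Data.Rational as ℚ using (ℚ; 0ℚ; 1ℚ; _/_; _+_; _-_; _*_; _⊔_) renaming (_≤_ to _≤ℚ_)
import Data.Rational.Properties as ℚ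
open import Data.Rational.Solver using (module +-*-Solver)
import Data.Rational.Unnormalised as ℚᵘ
import Data.Rational.Unnormalised.Properties as ℚᵘ
open import Data.Sum using (_⊎_; inj₁; inj₂)
import Data.Vec as Vec
open import Function using (_∘_; Equivalence)
open import Function.Definitions using (Injective)
open import Relation.Binary using (tri<; tri≈; tri>)
open import Relation.Binary.Definitions using (DecidableEquality)
open import Relation.Binary.PropositionalEquality
open import Relation.Nullary using (¬_; yes; no; does; contradiction)
open import Relation.Nullary.Decidable using (dec-false; dec-true; ¬?; T?)
open import Relation.Unary using (Decidable)

open import Defs hiding (sym)

private
  variable
    A B : Set
    n v : ℕ

𝟙 : Bool → ℕ
𝟙 b = if b then 1 else 0

∧-true⁻ : ∀ {b c} → b ∧ c ≡ true → b ≡ true × c ≡ true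
∧-true⁻ {true} {true} _ = refl , refl

∨-resolve : ∀ {b c} → b ∨ c ≡ true → not b ≡ true → c ≡ true
∨-resolve {false} c≡true _ = c≡true

∧³-true : ∀ {a b c} → a ≡ true → b ≡ true → c ≡ true → a ∧ (b ∧ c) ≡ true
∧³-true refl refl refl = refl

module _ {p q : A → Bool} where

  count-cong : (∀ x → p x ≡ q x) → ∀ xs → count p xs ≡ count q xs
  count-cong p≗q []       = refl
  count-cong p≗q (x ∷ xs) = cong₂ ℕ._+_ (cong 𝟙 (p≗q x)) (count-cong p≗q xs)

  count-mono : (∀ x → p x ≡ true → q x ≡ true) → ∀ xs → count p xs ≤ count q xs
  count-mono p⇒q []       = z≤n
  count-mono p⇒q (x ∷ xs) = ℕ.+-mono-≤ (𝟙-mono (p⇒q x)) (count-mono p⇒q xs)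
    where
      𝟙-mono : ∀ {b c} → (b ≡ true → c ≡ true) → 𝟙 b ≤ 𝟙 c
      𝟙-mono {false} _   = z≤n
      𝟙-mono {true}  b⇒c rewrite b⇒c refl = ℕ.≤-refl

  count-∨ : ∀ xs → count (λ x → p x ∨ q x) xs ≤ count p xs ℕ.+ count q xs
  count-∨ []       = z≤n
  count-∨ (x ∷ xs) with p x | q x
  ... | true  | true  = s≤s (ℕ.≤-trans (count-∨ xs) (ℕ.+-monoʳ-≤ (count p xs) (ℕ.n≤1+n _)))
  ... | true  | false = s≤s (count-∨ xs)
  ... | false | true  = ℕ.≤-trans (s≤s (count-∨ xs)) (ℕ.≤-reflexive (sym (ℕ.+-suc _ _)))
  ... | false | false = count-∨ xs

  count-∨-disjoint : (∀ x → p x ∧ q x ≡ false) →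
                     ∀ xs → count (λ x → p x ∨ q x) xs ≡ count p xs ℕ.+ count q xs
  count-∨-disjoint disj []       = refl
  count-∨-disjoint disj (x ∷ xs) with p x | q x | disj x
  ... | true  | false | _ = cong suc (count-∨-disjoint disj xs)
  ... | false | true  | _ = trans (cong suc (count-∨-disjoint disj xs)) (sym (ℕ.+-suc _ _))
  ... | false | false | _ = count-∨-disjoint disj xs

  count-split : ∀ xs → count p xs ≡ count (λ x → p x ∧ q x) xs ℕ.+ count (λ x → p x ∧ not (q x)) xs
  count-split []       = refl
  count-split (x ∷ xs) with p x | q x
  ... | true  | true  = cong suc (count-split xs)
  ... | true  | false = trans (cong suc (count-split xs)) (sym (ℕ.+-suc _ _))
  ... | false | _     = count-split xs

module _ {p : A → Bool} where

  count-none : ∀ xs → (∀ x → x ∈ xs → p x ≡ false) → count p xs ≡ 0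
  count-none []       _    = refl
  count-none (x ∷ xs) none rewrite none x (here refl) = count-none xs (λ y y∈ → none y (there y∈))

  count-all : ∀ xs → (∀ x → x ∈ xs → p x ≡ true) → count p xs ≡ length xs
  count-all []       _   = refl
  count-all (x ∷ xs) all rewrite all x (here refl) = cong suc (count-all xs (λ y y∈ → all y (there y∈)))

  count-not : ∀ xs → count (not ∘ p) xs ℕ.+ count p xs ≡ length xs
  count-not []       = refl
  count-not (x ∷ xs) with p x
  ... | true  = trans (ℕ.+-suc _ _) (cong suc (count-not xs))
  ... | false = cong suc (count-not xs)

  count-map : (f : B → A) → ∀ xs → count p (map f xs) ≡ count (p ∘ f) xs
  count-map f []       = refl
  count-map f (x ∷ xs) = cong (𝟙 (p (f x)) ℕ.+_) (count-map f xs)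

  count>0⇒∃ : ∀ xs → 0 < count p xs → ∃[ x ] (x ∈ xs × p x ≡ true)
  count>0⇒∃ (x ∷ xs) pos with p x in px
  ... | true  = x , here refl , px
  ... | false with count>0⇒∃ xs pos
  ...   | y , y∈ , py = y , there y∈ , py

  ∈⇒count>0 : ∀ {x xs} → x ∈ xs → p x ≡ true → 0 < count p xs
  ∈⇒count>0 {x} (here refl) px rewrite px = s≤s z≤n
  ∈⇒count>0 {xs = y ∷ _} (there x∈) px = ℕ.≤-trans (∈⇒count>0 x∈ px) (ℕ.m≤n+m _ (𝟙 (p y)))

  ∈⇒count≥2 : ∀ {x y xs} → x ∈ xs → y ∈ xs → x ≢ y → p x ≡ true → p y ≡ true → 2 ≤ count p xs
  ∈⇒count≥2 (here refl)  (here refl)  x≢y _  _  = contradiction refl x≢y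
  ∈⇒count≥2 (here refl)  (there y∈)   _   px py rewrite px = s≤s (∈⇒count>0 y∈ py)
  ∈⇒count≥2 (there x∈)   (here refl)  _   px py rewrite py = s≤s (∈⇒count>0 x∈ px)
  ∈⇒count≥2 {xs = z ∷ _} (there x∈) (there y∈) x≢y px py =
    ℕ.≤-trans (∈⇒count≥2 x∈ y∈ x≢y px py) (ℕ.m≤n+m _ (𝟙 (p z)))

  count≤1 : ∀ {xs} → Unique xs →
            (∀ {x y} → x ∈ xs → y ∈ xs → p x ≡ true → p y ≡ true → x ≡ y) → count p xs ≤ 1
  count≤1 {[]}     _            _   = z≤n
  count≤1 {x ∷ xs} (x∉xs ∷ uxs) one with p x in px
  ... | true  = ℕ.≤-reflexive (cong suc (count-none xs none))
    where
      none : ∀ y → y ∈ xs → p y ≡ false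
      none y y∈ with p y in py
      ... | false = refl
      ... | true  = contradiction (one (here refl) (there y∈) px py) (All.lookup x∉xs y∈)
  ... | false = count≤1 uxs (λ x∈ y∈ → one (there x∈) (there y∈))

module _ {A : Set} (_≟_ : DecidableEquality A) where

  open import Data.List.Membership.DecPropositional _≟_ using (_∈?_)

  count-∧-≟ : (p : A → Bool) {y : A} {xs : List A} → Unique xs → y ∈ xs →
              count (λ x → p x ∧ does (x ≟ y)) xs ≡ 𝟙 (p y)
  count-∧-≟ p {y} {x ∷ xs} (x∉xs ∷ _) (here refl) with x ≟ x
  ... | no x≢x = contradiction refl x≢x
  ... | yes _  = trans (cong₂ ℕ._+_ (cong 𝟙 (∧-identityʳ (p x))) (count-none xs none)) (ℕ.+-identityʳ _)
    where
      none : ∀ z → z ∈ xs → p z ∧ does (z ≟ x) ≡ false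
      none z z∈ with z ≟ x
      ... | no _     = ∧-zeroʳ (p z)
      ... | yes refl = contradiction refl (All.lookup x∉xs z∈)
  count-∧-≟ p {y} {x ∷ xs} (x∉xs ∷ uxs) (there y∈) with x ≟ y
  ... | yes refl = contradiction refl (All.lookup x∉xs y∈)
  ... | no _     = trans (cong (ℕ._+ _) (cong 𝟙 (∧-zeroʳ (p x)))) (count-∧-≟ p uxs y∈)

  count-∧-∈ : (p : A → Bool) {xs ys : List A} → Unique xs → Unique ys → (∀ {y} → y ∈ ys → y ∈ xs) →
              count (λ x → p x ∧ does (x ∈? ys)) xs ≡ count p ys
  count-∧-∈ p {xs} {[]} _ _ _ = count-none xs (λ x _ → ∧-zeroʳ (p x))
  count-∧-∈ p {xs} {y ∷ ys} uxs (y∉ys ∷ uys) ys⊆xs = begin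
    count (λ x → p x ∧ (does (x ≟ y) ∨ does (x ∈? ys))) xs
      ≡⟨ count-cong (λ x → ∧-distribˡ-∨ (p x) _ _) xs ⟩
    count (λ x → (p x ∧ does (x ≟ y)) ∨ (p x ∧ does (x ∈? ys))) xs
      ≡⟨ count-∨-disjoint disjoint xs ⟩
    count (λ x → p x ∧ does (x ≟ y)) xs ℕ.+ count (λ x → p x ∧ does (x ∈? ys)) xs
      ≡⟨ cong₂ ℕ._+_ (count-∧-≟ p uxs (ys⊆xs (here refl))) (count-∧-∈ p uxs uys (ys⊆xs ∘ there)) ⟩
    𝟙 (p y) ℕ.+ count p ys
      ∎
    where
      open ≡-Reasoning
      disjoint : ∀ x → (p x ∧ does (x ≟ y)) ∧ (p x ∧ does (x ∈? ys)) ≡ false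
      disjoint x with x ≟ y
      ... | no _     = cong (_∧ (p x ∧ does (x ∈? ys))) (∧-zeroʳ (p x))
      ... | yes refl rewrite dec-false (x ∈? ys) (All¬⇒¬Any y∉ys) =
        trans (cong ((p x ∧ true) ∧_) (∧-zeroʳ (p x))) (∧-zeroʳ (p x ∧ true))

/1≡mkℚ : ∀ k → + k / 1 ≡ ℚ.mkℚ (+ k) 0 (Coprime.sym (1-coprimeTo k))
/1≡mkℚ k = ℚ.normalize-coprime (Coprime.sym (1-coprimeTo k))

-- Opaque, so that unification treats toℚ as rigid instead of unfolding the normalisation in _/_.
opaque
  toℚ : ℕ → ℚ
  toℚ k = + k / 1

  toℚ-/1 : ∀ k → toℚ k ≡ + k / 1
  toℚ-/1 k = refl

  toℚ-0 : toℚ 0 ≡ 0ℚ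
  toℚ-0 = refl

  toℚ-1 : toℚ 1 ≡ 1ℚ
  toℚ-1 = refl

  toℚ-+ : ∀ a b → toℚ (a ℕ.+ b) ≡ toℚ a + toℚ b
  toℚ-+ a b rewrite /1≡mkℚ a | /1≡mkℚ b =
    cong₂ (λ i j → (i ℤ.+ j) / 1) (sym (ℤ.*-identityʳ (+ a))) (sym (ℤ.*-identityʳ (+ b)))

  toℚ-mono-≤ : ∀ {a b} → a ≤ b → toℚ a ≤ℚ toℚ b
  toℚ-mono-≤ {a} {b} a≤b rewrite /1≡mkℚ a | /1≡mkℚ b =
    ℚ.*≤* (subst₂ ℤ._≤_ (sym (ℤ.*-identityʳ (+ a))) (sym (ℤ.*-identityʳ (+ b))) (ℤ.+≤+ a≤b))

  /-*-cancelʳ : ∀ i k → (i / suc k) * toℚ (suc k) ≡ i / 1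
  /-*-cancelʳ i k = ℚ.toℚᵘ-injective (begin
    ℚ.toℚᵘ ((i / suc k) * toℚ (suc k))
      ≈⟨ ℚ.toℚᵘ-homo-* (i / suc k) (toℚ (suc k)) ⟩
    ℚ.toℚᵘ (i / suc k) ℚᵘ.* ℚ.toℚᵘ (toℚ (suc k))
      ≈⟨ ℚᵘ.*-cong (ℚ.toℚᵘ-fromℚᵘ (ℚᵘ.mkℚᵘ i k)) (ℚ.toℚᵘ-fromℚᵘ (ℚᵘ.mkℚᵘ (+ suc k) 0)) ⟩
    ℚᵘ.mkℚᵘ i k ℚᵘ.* ℚᵘ.mkℚᵘ (+ suc k) 0
      ≈⟨ ℚᵘ.*≡* (ℤ.*-assoc i (+ suc k) (+ 1)) ⟩
    ℚᵘ.mkℚᵘ i 0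
      ≈⟨ ℚᵘ.≃-sym (ℚ.toℚᵘ-fromℚᵘ (ℚᵘ.mkℚᵘ i 0)) ⟩
    ℚ.toℚᵘ (i / 1) ∎)
    where open ℚᵘ.≃-Reasoning

0≤toℚ : ∀ a → 0ℚ ≤ℚ toℚ a
0≤toℚ a = subst (_≤ℚ toℚ a) toℚ-0 (toℚ-mono-≤ z≤n)

/1-minus-one : ∀ e → (+ e ℤ.- + 1) / 1 ≡ toℚ e - 1ℚ
/1-minus-one zero    = cong (_- 1ℚ) (sym toℚ-0)
/1-minus-one (suc e) = begin
  (+ e) / 1            ≡⟨ sym (toℚ-/1 e) ⟩
  toℚ e                ≡⟨ solve 1 (λ x → x := con 1ℚ :+ x :- con 1ℚ) refl (toℚ e) ⟩
  1ℚ + toℚ e - 1ℚ      ≡⟨ cong (λ x → x + toℚ e - 1ℚ) (sym toℚ-1) ⟩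
  toℚ 1 + toℚ e - 1ℚ   ≡⟨ cong (_- 1ℚ) (sym (toℚ-+ 1 e)) ⟩
  toℚ (suc e) - 1ℚ     ∎
  where open ≡-Reasoning; open +-*-Solver

∑ : List A → (A → ℚ) → ℚ
∑ []       f = 0ℚ
∑ (x ∷ xs) f = f x + ∑ xs f

infixr 7 ∑
syntax ∑ xs (λ x → e) = ∑[ x ∈ xs ] e

module _ {f g : A → ℚ} where

  ∑-cong : ∀ xs → (∀ x → x ∈ xs → f x ≡ g x) → ∑ xs f ≡ ∑ xs g
  ∑-cong []       _   = refl
  ∑-cong (x ∷ xs) f≗g = cong₂ _+_ (f≗g x (here refl)) (∑-cong xs (λ y y∈ → f≗g y (there y∈)))

  ∑-mono-≤ : ∀ xs → (∀ x → x ∈ xs → f x ≤ℚ g x) → ∑ xs f ≤ℚ ∑ xs g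
  ∑-mono-≤ []       _   = ℚ.≤-refl
  ∑-mono-≤ (x ∷ xs) f≤g = ℚ.+-mono-≤ (f≤g x (here refl)) (∑-mono-≤ xs (λ y y∈ → f≤g y (there y∈)))

  ∑-+ : ∀ xs → ∑[ x ∈ xs ] (f x + g x) ≡ ∑ xs f + ∑ xs g
  ∑-+ []       = refl
  ∑-+ (x ∷ xs) = trans (cong (_+_ (f x + g x)) (∑-+ xs)) (interchange (f x) (g x) (∑ xs f) (∑ xs g))
    where open CommSemigroupProperties (CommutativeMonoid.commutativeSemigroup ℚ.+-0-commutativeMonoid)

module _ {f : A → ℚ} where

  ∑-*ˡ : ∀ r xs → ∑[ x ∈ xs ] (r * f x) ≡ r * ∑ xs f
  ∑-*ˡ r []       = sym (ℚ.*-zeroʳ r)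
  ∑-*ˡ r (x ∷ xs) = trans (cong (_+_ (r * f x)) (∑-*ˡ r xs)) (sym (ℚ.*-distribˡ-+ r (f x) (∑ xs f)))

  0≤∑ : ∀ xs → (∀ x → x ∈ xs → 0ℚ ≤ℚ f x) → 0ℚ ≤ℚ ∑ xs f
  0≤∑ []       _  = ℚ.≤-refl
  0≤∑ (x ∷ xs) f≥0 = ℚ.+-mono-≤ (f≥0 x (here refl)) (0≤∑ xs (λ y y∈ → f≥0 y (there y∈)))

  ∈⇒≤∑ : ∀ {x xs} → (∀ y → y ∈ xs → 0ℚ ≤ℚ f y) → x ∈ xs → f x ≤ℚ ∑ xs f
  ∈⇒≤∑ {x} {_ ∷ xs} f≥0 (here refl) =
    ℚ.≤-trans (ℚ.≤-reflexive (sym (ℚ.+-identityʳ (f x))))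
              (ℚ.+-monoʳ-≤ (f x) (0≤∑ xs (λ y y∈ → f≥0 y (there y∈))))
  ∈⇒≤∑ {x} {y ∷ xs} f≥0 (there x∈) =
    ℚ.≤-trans (∈⇒≤∑ (λ z z∈ → f≥0 z (there z∈)) x∈)
      (ℚ.≤-trans (ℚ.≤-reflexive (sym (ℚ.+-identityˡ (∑ xs f)))) (ℚ.+-monoˡ-≤ (∑ xs f) (f≥0 y (here refl))))

  ∑-partition : {P : A → Set} (P? : Decidable P) → ∀ xs →
                ∑ xs f ≡ ∑ (filter P? xs) f + ∑ (filter (¬? ∘ P?) xs) f
  ∑-partition P? []       = sym (ℚ.+-identityʳ 0ℚ)
  ∑-partition P? (x ∷ xs) with does (P? x)
  ... | true  = trans (cong (_+_ (f x)) (∑-partition P? xs)) (sym (ℚ.+-assoc (f x) _ _))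
  ... | false = trans (cong (_+_ (f x)) (∑-partition P? xs)) (x∙yz≈y∙xz (f x) (∑ (filter P? xs) f) _)
    where open CommSemigroupProperties (CommutativeMonoid.commutativeSemigroup ℚ.+-0-commutativeMonoid)

count≤∑ : (p : A → Bool) (q : B → A → Bool) (xs : List A) (M : List B) →
          (∀ x → x ∈ xs → p x ≡ true → ∃[ s ] (s ∈ M × q s x ≡ true)) →
          toℚ (count p xs) ≤ℚ ∑[ s ∈ M ] toℚ (count (q s) xs)
count≤∑ p q xs [] covered = ℚ.≤-reflexive (trans (cong toℚ (count-none xs uncovered)) toℚ-0)
  where
    uncovered : ∀ x → x ∈ xs → p x ≡ false
    uncovered x x∈ with p x in px
    ... | false = refl
    ... | true with covered x x∈ px
    ...   | _ , () , _
count≤∑ p q xs (s ∷ M) covered = begin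
  toℚ (count p xs)
    ≡⟨ cong toℚ (count-split xs) ⟩
  toℚ (count (λ x → p x ∧ q s x) xs ℕ.+ count (λ x → p x ∧ not (q s x)) xs)
    ≡⟨ toℚ-+ _ _ ⟩
  toℚ (count (λ x → p x ∧ q s x) xs) + toℚ (count (λ x → p x ∧ not (q s x)) xs)
    ≤⟨ ℚ.+-mono-≤ (toℚ-mono-≤ (count-mono (λ x → proj₂ ∘ ∧-true⁻) xs)) (count≤∑ _ q xs M covered′) ⟩
  toℚ (count (q s) xs) + ∑[ s′ ∈ M ] toℚ (count (q s′) xs) ∎
  where
    open ℚ.≤-Reasoning
    covered′ : ∀ x → x ∈ xs → p x ∧ not (q s x) ≡ true → ∃[ s′ ] (s′ ∈ M × q s′ x ≡ true)
    covered′ x x∈ px∧¬qsx with ∧-true⁻ px∧¬qsx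
    ... | px , ¬qsx with covered x x∈ px
    ...   | _  , here refl , qsx  = contradiction (trans (sym (cong not qsx)) ¬qsx) λ ()
    ...   | s′ , there s′∈ , qs′x = s′ , s′∈ , qs′x

∣_∣ : (Fin n → Bool) → ℕ
∣_∣ {n} X = count X (allFin n)

∣all∣≡n : {X : Fin n → Bool} → (∀ i → X i ≡ true) → ∣ X ∣ ≡ n
∣all∣≡n {n} all = trans (count-all (allFin n) (λ i _ → all i)) (length-tabulate (λ i → i))

∣∁X∣+∣X∣≡n : (X : Fin n → Bool) → ∣ not ∘ X ∣ ℕ.+ ∣ X ∣ ≡ n
∣∁X∣+∣X∣≡n {n} X = trans (count-not (allFin n)) (length-tabulate (λ i → i))

∣∣-suc : (f : Fin (suc n) → Bool) → ∣ f ∣ ≡ 𝟙 (f zero) ℕ.+ ∣ f ∘ suc ∣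
∣∣-suc {n} f =
  cong (𝟙 (f zero) ℕ.+_) (trans (cong (count f) (sym (map-tabulate (λ i → i) suc))) (count-map suc (allFin n)))

open module FinMembership {n} = Data.List.Membership.DecPropositional (_≟_ {n}) using (_∈?_)

image : (Fin v → Fin n) → Fin n → Bool
image {v} φ i = does (i ∈? map φ (allFin v))

image-∋ : (φ : Fin v → Fin n) → ∀ a → image φ (φ a) ≡ true
image-∋ {v} φ a = dec-true (φ a ∈? map φ (allFin v)) (∈-map⁺ φ (∈-allFin a))

module _ {φ : Fin v → Fin n} (φ-inj : Injective _≡_ _≡_ φ) where

  ∣∩image∣ : ∀ X → ∣ (λ i → X i ∧ image φ i) ∣ ≡ ∣ X ∘ φ ∣
  ∣∩image∣ X = trans
    (count-∧-∈ _≟_ X (Unique.allFin⁺ n) (Unique.map⁺ φ-inj (Unique.allFin⁺ v)) (λ _ → ∈-allFin _))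
    (count-map φ (allFin v))

  ∣image∣ : ∣ image φ ∣ ≡ v
  ∣image∣ = trans (∣∩image∣ (λ _ → true)) (∣all∣≡n (λ _ → refl))

update : (Fin v → Fin n) → Fin v → Fin n → Fin v → Fin n
update φ z x a = if does (a ≟ z) then x else φ a

update-at : (φ : Fin v → Fin n) (z : Fin v) (x : Fin n) → update φ z x z ≡ x
update-at φ z x rewrite dec-true (z ≟ z) refl = refl

update-else : (φ : Fin v → Fin n) {z a : Fin v} (x : Fin n) → a ≢ z → update φ z x a ≡ φ a
update-else φ {z} {a} x a≢z rewrite dec-false (a ≟ z) a≢z = refl

update-injective : {φ : Fin v → Fin n} → Injective _≡_ _≡_ φ → ∀ z {x} → (∀ a → φ a ≢ x) →
                   Injective _≡_ _≡_ (update φ z x)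
update-injective φ-inj z {x} x∉φ {a} {b} ψa≡ψb with a ≟ z | b ≟ z
... | yes a≡z | yes b≡z = trans a≡z (sym b≡z)
... | yes _   | no _    = contradiction (sym ψa≡ψb) (x∉φ b)
... | no _    | yes _   = contradiction ψa≡ψb (x∉φ a)
... | no _    | no _    = φ-inj ψa≡ψb

toSubset : (Fin v → Bool) → Subset v
toSubset = Vec.tabulate

∈-toSubset : (f : Fin v → Bool) → ∀ a → does (a Subset.∈? toSubset f) ≡ f a
∈-toSubset f zero with f zero
... | true  = refl
... | false = refl
∈-toSubset f (suc a) = ∈-toSubset (f ∘ suc) a

∣toSubset∣ : (f : Fin v → Bool) → ∣ toSubset f ∣ˢ ≡ ∣ f ∣
∣toSubset∣ {zero}  f = refl
∣toSubset∣ {suc v} f rewrite ∣∣-suc f with f zero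
... | true  = cong suc (∣toSubset∣ (f ∘ suc))
... | false = ∣toSubset∣ (f ∘ suc)

⁅_,_⁆ : Fin n → Fin n → Fin n → Bool
⁅ p , q ⁆ i = does (i ≟ p) ∨ does (i ≟ q)

⁅,⁆⁻ : ∀ {p q i : Fin n} → ⁅ p , q ⁆ i ≡ true → i ≡ p ⊎ i ≡ q
⁅,⁆⁻ {p = p} {q} {i} i∈ with i ≟ p | i ≟ q
... | yes i≡p | _       = inj₁ i≡p
... | no _    | yes i≡q = inj₂ i≡q

⁅,⁆-∋ˡ : (p q : Fin n) → ⁅ p , q ⁆ p ≡ true
⁅,⁆-∋ˡ p q = cong (_∨ does (p ≟ q)) (dec-true (p ≟ p) refl)

⁅,⁆-∋ʳ : (p q : Fin n) → ⁅ p , q ⁆ q ≡ true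
⁅,⁆-∋ʳ p q = trans (cong (does (q ≟ p) ∨_) (dec-true (q ≟ q) refl)) (∨-zeroʳ _)

endpoints∈⁅,⁆ : ∀ {p q x y : Fin n} → (x , y) ≡ (p , q) ⊎ (y , x) ≡ (p , q) →
                ⁅ p , q ⁆ x ≡ true × ⁅ p , q ⁆ y ≡ true
endpoints∈⁅,⁆ {p = p} {q} (inj₁ refl) = ⁅,⁆-∋ˡ p q , ⁅,⁆-∋ʳ p q
endpoints∈⁅,⁆ {p = p} {q} (inj₂ refl) = ⁅,⁆-∋ʳ p q , ⁅,⁆-∋ˡ p q

∣⁅,⁆∣≤2 : (p q : Fin n) → ∣ ⁅ p , q ⁆ ∣ ≤ 2
∣⁅,⁆∣≤2 {n} p q = ℕ.≤-trans (count-∨ (allFin n))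
  (ℕ.≤-reflexive (cong₂ ℕ._+_ (count-∧-≟ _≟_ (λ _ → true) (Unique.allFin⁺ n) (∈-allFin p))
                             (count-∧-≟ _≟_ (λ _ → true) (Unique.allFin⁺ n) (∈-allFin q))))

equal-or-swapped : ∀ {p q x y x′ y′ : A} → x ≡ p ⊎ x ≡ q → y ≡ p ⊎ y ≡ q → x ≢ y →
              x′ ≡ p ⊎ x′ ≡ q → y′ ≡ p ⊎ y′ ≡ q → x′ ≢ y′ →
              (x ≡ x′ × y ≡ y′) ⊎ (x ≡ y′ × y ≡ x′)
equal-or-swapped (inj₁ refl) (inj₁ refl) x≢y _ _ _ = contradiction refl x≢y
equal-or-swapped (inj₂ refl) (inj₂ refl) x≢y _ _ _ = contradiction refl x≢y
equal-or-swapped _ _ _ (inj₁ refl) (inj₁ refl) x′≢y′ = contradiction refl x′≢y′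
equal-or-swapped _ _ _ (inj₂ refl) (inj₂ refl) x′≢y′ = contradiction refl x′≢y′
equal-or-swapped (inj₁ refl) (inj₂ refl) _ (inj₁ refl) (inj₂ refl) _ = inj₁ (refl , refl)
equal-or-swapped (inj₁ refl) (inj₂ refl) _ (inj₂ refl) (inj₁ refl) _ = inj₂ (refl , refl)
equal-or-swapped (inj₂ refl) (inj₁ refl) _ (inj₁ refl) (inj₂ refl) _ = inj₂ (refl , refl)
equal-or-swapped (inj₂ refl) (inj₁ refl) _ (inj₂ refl) (inj₁ refl) _ = inj₁ (refl , refl)

pairs-unique : Unique (pairs v)
pairs-unique {v} = Unique.filter⁺ _ (Unique.cartesianProduct⁺ (Unique.allFin⁺ v) (Unique.allFin⁺ v))

∈-pairs⁺ : ∀ {a b : Fin v} → toℕ a < toℕ b → (a , b) ∈ pairs v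
∈-pairs⁺ a<b = ∈-filter⁺ _ (∈-cartesianProduct⁺ (∈-allFin _) (∈-allFin _)) a<b

∈-pairs⁻ : ∀ {a b : Fin v} → (a , b) ∈ pairs v → toℕ a < toℕ b
∈-pairs⁻ {v} ab∈ = proj₂ (∈-filter⁻ _ {xs = Data.List.cartesianProduct (allFin v) (allFin v)} ab∈)

∈-pairs⇒≢ : ∀ {a b : Fin v} → (a , b) ∈ pairs v → a ≢ b
∈-pairs⇒≢ ab∈ refl = ℕ.<-irrefl refl (∈-pairs⁻ ab∈)

∈-pairs-either : ∀ {a b : Fin v} → a ≢ b → (a , b) ∈ pairs v ⊎ (b , a) ∈ pairs v
∈-pairs-either {a = a} {b} a≢b with ℕ.<-cmp (toℕ a) (toℕ b)
... | tri< a<b _ _ = inj₁ (∈-pairs⁺ a<b)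
... | tri≈ _ a≡b _ = contradiction (toℕ-injective a≡b) a≢b
... | tri> _ _ b<a = inj₂ (∈-pairs⁺ b<a)

pairs-onto-⁅,⁆≤1 : {φ : Fin v → Fin n} → Injective _≡_ _≡_ φ → (p q : Fin n) →
                  count (λ ab → ⁅ p , q ⁆ (φ (proj₁ ab)) ∧ ⁅ p , q ⁆ (φ (proj₂ ab))) (pairs v) ≤ 1
pairs-onto-⁅,⁆≤1 {φ = φ} φ-inj p q = count≤1 pairs-unique same
  where
    same : ∀ {ab ab′} → ab ∈ pairs _ → ab′ ∈ pairs _ →
           ⁅ p , q ⁆ (φ (proj₁ ab)) ∧ ⁅ p , q ⁆ (φ (proj₂ ab)) ≡ true →
           ⁅ p , q ⁆ (φ (proj₁ ab′)) ∧ ⁅ p , q ⁆ (φ (proj₂ ab′)) ≡ true → ab ≡ ab′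
    same {a , b} {a′ , b′} ab∈ ab′∈ ab⊆ ab′⊆
      with equal-or-swapped (⁅,⁆⁻ (proj₁ (∧-true⁻ ab⊆))) (⁅,⁆⁻ (proj₂ (∧-true⁻ ab⊆)))
                            (∈-pairs⇒≢ ab∈ ∘ φ-inj)
                            (⁅,⁆⁻ (proj₁ (∧-true⁻ ab′⊆))) (⁅,⁆⁻ (proj₂ (∧-true⁻ ab′⊆)))
                            (∈-pairs⇒≢ ab′∈ ∘ φ-inj)
    ... | inj₁ (φa≡φa′ , φb≡φb′) = cong₂ _,_ (φ-inj φa≡φa′) (φ-inj φb≡φb′)
    ... | inj₂ (φa≡φb′ , φb≡φa′) with φ-inj φa≡φb′ | φ-inj φb≡φa′
    ...   | refl | refl = contradiction (∈-pairs⁻ ab′∈) (ℕ.<-asym (∈-pairs⁻ ab∈))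

module _ (G : Graph v) where

  adj⇒≢ : ∀ {a b} → adj G a b ≡ true → a ≢ b
  adj⇒≢ {a} ab refl = contradiction (trans (sym (irrefl G a)) ab) λ ()

  degree<v : ∀ a → degree G a < v
  degree<v a = ℕ.≤-trans (ℕ.+-monoˡ-≤ (degree G a) non-neighbours>0)
                         (ℕ.≤-reflexive (∣∁X∣+∣X∣≡n (adj G a)))
    where
      non-neighbours>0 : 0 < ∣ not ∘ adj G a ∣
      non-neighbours>0 = ∈⇒count>0 (∈-allFin a) (cong not (irrefl G a))

  neighbour : ∀ {a} → 0 < degree G a → ∃[ b ] adj G a b ≡ true
  neighbour {a} deg>0 with count>0⇒∃ (allFin v) deg>0
  ... | b , _ , ab = b , ab

edgeWithin : Graph v → (Fin v → Bool) → Fin v × Fin v → Bool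
edgeWithin H S ab = adj H (proj₁ ab) (proj₂ ab) ∧ (S (proj₁ ab) ∧ S (proj₂ ab))

edgesWithin : Graph v → (Fin v → Bool) → ℕ
edgesWithin {v} H S = count (edgeWithin H S) (pairs v)

module _ (H : Graph v) where

  edgeCount-split : ∀ S → edgeCount H ≡ edgesWithin H S ℕ.+ edgesMeeting H (toSubset (not ∘ S))
  edgeCount-split S =
    trans (count-split (pairs v)) (cong (edgesWithin H S ℕ.+_) (count-cong meets-complement (pairs v)))
    where
      not-∧ : ∀ x y → not (x ∧ y) ≡ not x ∨ not y
      not-∧ true  _ = refl
      not-∧ false _ = refl
      meets-complement : ∀ ab → adj H (proj₁ ab) (proj₂ ab) ∧ not (S (proj₁ ab) ∧ S (proj₂ ab))
                     ≡ adj H (proj₁ ab) (proj₂ ab) ∧ (does (proj₁ ab Subset.∈? toSubset (not ∘ S))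
                                                      ∨ does (proj₂ ab Subset.∈? toSubset (not ∘ S)))
      meets-complement (a , b) = cong (adj H a b ∧_)
        (trans (not-∧ (S a) (S b)) (sym (cong₂ _∨_ (∈-toSubset (not ∘ S) a) (∈-toSubset (not ∘ S) b))))

  edgesMeeting>0 : ∀ {U a} → a Subset.∈ U → 0 < degree H a → 0 < edgesMeeting H U
  edgesMeeting>0 {U} {a} a∈U deg>0 with neighbour H deg>0
  ... | b , ab with ∈-pairs-either (adj⇒≢ H ab)
  ...   | inj₁ ab∈ = ∈⇒count>0 ab∈ (cong₂ _∧_ ab (cong (_∨ _) (dec-true (a Subset.∈? U) a∈U)))
  ...   | inj₂ ba∈ = ∈⇒count>0 ba∈ (cong₂ _∧_ (trans (Graph.sym H b a) ab)
                       (trans (cong (_ ∨_) (dec-true (a Subset.∈? U) a∈U)) (∨-zeroʳ _)))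

  edgeCount>0 : ∀ {a} → 0 < degree H a → 0 < edgeCount H
  edgeCount>0 {a} deg>0 = ℕ.≤-trans (edgesMeeting>0 (Subset.∈⊤ {x = a}) deg>0)
    (count-mono (λ ab e → proj₁ (∧-true⁻ e)) (pairs v))

∈-allSubsets : (U : Subset v) → U ∈ allSubsets v
∈-allSubsets {zero}  Vec.[]      = here refl
∈-allSubsets {suc v} (b Vec.∷ U) = ∈-concatMap⁺ _ (Any.map (λ { refl → b∷U∈ b }) (∈-allSubsets U))
  where
    b∷U∈ : ∀ b → b Vec.∷ U ∈ (true Vec.∷ U) ∷ (false Vec.∷ U) ∷ []
    b∷U∈ true  = here refl
    b∷U∈ false = there (here refl)

minList≤ : ∀ {x xs} → x ∈ xs → minList xs ≤ℚ x
minList≤ {xs = _ ∷ []}     (here refl) = ℚ.≤-refl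
minList≤ {xs = x ∷ y ∷ xs} (here refl) = ℚ.p⊓q≤p x (minList (y ∷ xs))
minList≤ {xs = x ∷ y ∷ xs} (there z∈)  = ℚ.≤-trans (ℚ.p⊓q≤q x (minList (y ∷ xs))) (minList≤ z∈)

0≤minList : ∀ xs → (∀ x → x ∈ xs → 0ℚ ≤ℚ x) → 0ℚ ≤ℚ minList xs
0≤minList []           _   = ℚ.≤-refl
0≤minList (x ∷ [])     x≥0 = x≥0 x (here refl)
0≤minList (x ∷ y ∷ xs) x≥0 =
  ℚ.⊓-glb (x≥0 x (here refl)) (0≤minList (y ∷ xs) (λ z z∈ → x≥0 z (there z∈)))

admissible⇒∣U∣>0 : (U : Subset v) → T (admissible 2 U) → 0 < ∣ U ∣ˢ
admissible⇒∣U∣>0 U adm = ℕ.≤ᵇ⇒≤ 1 ∣ U ∣ˢ (proj₁ (Equivalence.to T-∧ adm))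

∣U∣>0⇒Nonempty : (U : Subset v) → 0 < ∣ U ∣ˢ → Subset.Nonempty U
∣U∣>0⇒Nonempty {v} U |U|>0 with Subset.nonempty? U
... | yes ne = ne
... | no ¬ne =
  contradiction (trans (cong ∣_∣ˢ (Subset.Empty-unique ¬ne)) (Subset.∣⊥∣≡0 v)) (ℕ.>⇒≢ |U|>0)

module _ (H : Graph v) where

  ratio-suc : ∀ U {k} → ∣ U ∣ˢ ≡ suc k → ratio H U ≡ (+ edgesMeeting H U ℤ.- + 1) / suc k
  ratio-suc U |U|≡ rewrite |U|≡ = refl

  LowerBoundsRatios : ℚ → Set
  LowerBoundsRatios γ = ∀ U → T (admissible 2 U) → γ ≤ℚ ratio H U

  γ-lowerBoundsRatios : LowerBoundsRatios (γ H 2)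
  γ-lowerBoundsRatios U adm =
    minList≤ (∈-map⁺ (ratio H) (∈-filter⁺ (λ U → T? (admissible 2 U)) (∈-allSubsets U) adm))

  ratio-bound : ∀ {γ} → LowerBoundsRatios γ → ∀ U → 0 < ∣ U ∣ → 2 ≤ v ∸ ∣ U ∣ →
                γ * toℚ ∣ U ∣ ≤ℚ toℚ (edgesMeeting H (toSubset U)) - 1ℚ
  ratio-bound {γ} γ≤ U |U|>0 2≤rest with ∣ U ∣ in |U|≡
  ... | suc k = begin
    γ * toℚ (suc k)
      ≤⟨ ℚ.*-monoʳ-≤-nonNeg (toℚ (suc k)) {{ℚ.nonNegative (0≤toℚ (suc k))}} (γ≤ (toSubset U) admissible-U) ⟩
    ratio H (toSubset U) * toℚ (suc k)
      ≡⟨ cong (_* toℚ (suc k)) (ratio-suc (toSubset U) (trans (∣toSubset∣ U) |U|≡)) ⟩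
    ((+ E ℤ.- + 1) / suc k) * toℚ (suc k)
      ≡⟨ /-*-cancelʳ (+ E ℤ.- + 1) k ⟩
    (+ E ℤ.- + 1) / 1
      ≡⟨ /1-minus-one E ⟩
    toℚ E - 1ℚ ∎
    where
      open ℚ.≤-Reasoning
      E = edgesMeeting H (toSubset U)
      admissible-U : T (admissible 2 (toSubset U))
      admissible-U rewrite ∣toSubset∣ U | |U|≡ = Equivalence.from T-∧ (ℕ.≤⇒≤ᵇ |U|>0 , ℕ.≤⇒≤ᵇ 2≤rest)

  ratio-nonneg : ∀ U → 0 < ∣ U ∣ˢ → 0 < edgesMeeting H U → 0ℚ ≤ℚ ratio H U
  ratio-nonneg U |U|>0 E>0 rewrite ratio-suc U (sym (ℕ.suc-pred ∣ U ∣ˢ {{ℕ.>-nonZero |U|>0}}))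
    with edgesMeeting H U | E>0
  ... | suc E | _ = ℚ.nonNegative⁻¹ _ {{ℚ.normalize-nonNeg E _}}

  0≤γ : (∀ a → 0 < degree H a) → 0ℚ ≤ℚ γ H 2
  0≤γ deg>0 = 0≤minList _ ratio≥0
    where
      ratio≥0 : ∀ r → r ∈ map (ratio H) (filter (λ U → T? (admissible 2 U)) (allSubsets v)) → 0ℚ ≤ℚ r
      ratio≥0 r r∈ with ∈-map⁻ (ratio H) r∈
      ... | U , U∈ , refl = ratio-nonneg U |U|>0 (edgesMeeting>0 H (proj₂ (∣U∣>0⇒Nonempty U |U|>0)) (deg>0 _))
        where
          |U|>0 : 0 < ∣ U ∣ˢ
          |U|>0 = admissible⇒∣U∣>0 U (proj₂ (∈-filter⁻ (λ U → T? (admissible 2 U)) {xs = allSubsets v} U∈))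

-- Covers by clusters

data Cluster (n : ℕ) : Set where
  edge : Fin n → Fin n → Cluster n
  blob : (Fin n → Bool) → Cluster n

members : Cluster n → Fin n → Bool
members (edge p q) = ⁅ p , q ⁆
members (blob X)   = X

Covers : List (Cluster n) → Fin n → Fin n → Set
Covers L x y = ∃[ s ] (s ∈ L × members s x ≡ true × members s y ≡ true)

CoversAllPairs : List (Cluster n) → Set
CoversAllPairs L = ∀ {x y} → x ≢ y → Covers L x y

Covers-∷ : ∀ {s L} {x y : Fin n} → Covers L x y → Covers (s ∷ L) x y
Covers-∷ (s , s∈ , sx , sy) = s , there s∈ , sx , sy

module Weight (H : Graph v) (γ : ℚ) where

  K : ℚ
  K = toℚ (edgeCount H) - 1ℚ

  -- A blob on X weighs the asserted lower bound γ(|X| − v) + e(H) − 1 for |X| vertices, floored at 0.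
  weight : Cluster n → ℚ
  weight (edge _ _) = 1ℚ
  weight (blob X)   = (γ * toℚ ∣ X ∣ + (K - γ * toℚ v)) ⊔ 0ℚ

  cost : List (Cluster n) → ℚ
  cost L = ∑ L weight

  0≤weight : (s : Cluster n) → 0ℚ ≤ℚ weight s
  0≤weight (edge _ _) = subst (0ℚ ≤ℚ_) toℚ-1 (0≤toℚ 1)
  0≤weight (blob X)   = ℚ.p≤q⊔p (γ * toℚ ∣ X ∣ + (K - γ * toℚ v)) 0ℚ

  weight-blob : (X : Fin n → Bool) → γ * toℚ ∣ X ∣ + (K - γ * toℚ v) ≤ℚ weight (blob X)
  weight-blob X = ℚ.p≤p⊔q _ 0ℚ

  edgeCount>0⇒0≤K : 0 < edgeCount H → 0ℚ ≤ℚ K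
  edgeCount>0⇒0≤K e>0 = begin
    0ℚ           ≡⟨ sym (ℚ.+-inverseʳ 1ℚ) ⟩
    1ℚ - 1ℚ      ≡⟨ cong (_- 1ℚ) (sym toℚ-1) ⟩
    toℚ 1 - 1ℚ   ≤⟨ ℚ.+-monoˡ-≤ (ℚ.- 1ℚ) (toℚ-mono-≤ e>0) ⟩
    K            ∎
    where open ℚ.≤-Reasoning

-- Merging the clusters met by a copy of H

module Merge (H : Graph v) (γ : ℚ) (0≤γ : 0ℚ ≤ℚ γ) (0≤K : 0ℚ ≤ℚ Weight.K H γ)
             (γ≤ratios : LowerBoundsRatios H γ) {φ : Fin v → Fin n} (φ-inj : Injective _≡_ _≡_ φ) where

  open Weight H γ

  Meets : Cluster n → Set
  Meets s = 2 ≤ ∣ members s ∘ φ ∣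

  meets? : Decidable Meets
  meets? s = 2 ℕ.≤? ∣ members s ∘ φ ∣

  outside : Cluster n → ℕ
  outside s = ∣ (λ i → members s i ∧ not (image φ i)) ∣

  spanned : Cluster n → ℕ
  spanned s = edgesWithin H (members s ∘ φ)

  FullBlob : Cluster n → Set
  FullBlob (edge _ _) = ⊥
  FullBlob (blob X)   = ∣ X ∘ φ ∣ ≡ v

  fullBlob? : Decidable FullBlob
  fullBlob? (edge _ _) = no λ ()
  fullBlob? (blob X)   = ∣ X ∘ φ ∣ ℕ.≟ v

  -- The part of K that s pays for when it is merged into the new blob.
  credit : Cluster n → ℚ
  credit s = if does (fullBlob? s) then K else toℚ (spanned s)

  credit-full : ∀ {s} → FullBlob s → credit s ≡ K
  credit-full {s} full = cong (λ b → if b then K else toℚ (spanned s)) (dec-true (fullBlob? s) full)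

  credit-partial : ∀ {s} → ¬ FullBlob s → credit s ≡ toℚ (spanned s)
  credit-partial {s} ¬full = cong (λ b → if b then K else toℚ (spanned s)) (dec-false (fullBlob? s) ¬full)

  0≤credit : ∀ s → 0ℚ ≤ℚ credit s
  0≤credit s with does (fullBlob? s)
  ... | true  = 0≤K
  ... | false = 0≤toℚ (spanned s)

  ∣members∣ : ∀ s → ∣ members s ∣ ≡ ∣ members s ∘ φ ∣ ℕ.+ outside s
  ∣members∣ s = trans (count-split (allFin n)) (cong (ℕ._+ outside s) (∣∩image∣ φ-inj (members s)))

  outside-edge≡0 : ∀ p q → Meets (edge p q) → outside (edge p q) ≡ 0
  outside-edge≡0 p q meets = ℕ.n≤0⇒n≡0 (ℕ.+-cancelˡ-≤ ∣ ⁅ p , q ⁆ ∘ φ ∣ _ 0 (begin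
    ∣ ⁅ p , q ⁆ ∘ φ ∣ ℕ.+ outside (edge p q) ≡⟨ sym (∣members∣ (edge p q)) ⟩
    ∣ ⁅ p , q ⁆ ∣                             ≤⟨ ∣⁅,⁆∣≤2 p q ⟩
    2                                         ≤⟨ meets ⟩
    ∣ ⁅ p , q ⁆ ∘ φ ∣                         ≡⟨ sym (ℕ.+-identityʳ _) ⟩
    ∣ ⁅ p , q ⁆ ∘ φ ∣ ℕ.+ 0                   ∎))
    where open ℕ.≤-Reasoning

  spanned-edge≤1 : ∀ p q → toℚ (spanned (edge p q)) ≤ℚ 1ℚ
  spanned-edge≤1 p q = subst (toℚ (spanned (edge p q)) ≤ℚ_) toℚ-1 (toℚ-mono-≤ (ℕ.≤-trans
    (count-mono (λ ab → proj₂ ∘ ∧-true⁻ {adj H (proj₁ ab) (proj₂ ab)}) (pairs v))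
    (pairs-onto-⁅,⁆≤1 φ-inj p q)))

  credit-edge : ∀ p q → Meets (edge p q) →
                credit (edge p q) + γ * toℚ (outside (edge p q)) ≤ℚ weight (edge p q)
  credit-edge p q meets = begin
    toℚ (spanned (edge p q)) + γ * toℚ (outside (edge p q))
      ≡⟨ cong (λ d → toℚ (spanned (edge p q)) + γ * d) (trans (cong toℚ (outside-edge≡0 p q meets)) toℚ-0) ⟩
    toℚ (spanned (edge p q)) + γ * 0ℚ
      ≡⟨ trans (cong (_+_ (toℚ (spanned (edge p q)))) (ℚ.*-zeroʳ γ)) (ℚ.+-identityʳ _) ⟩
    toℚ (spanned (edge p q))
      ≤⟨ spanned-edge≤1 p q ⟩
    1ℚ ∎
    where open ℚ.≤-Reasoning

  weight-blob-split : ∀ X → γ * (toℚ ∣ X ∘ φ ∣ + toℚ (outside (blob X))) + (K - γ * toℚ v) ≤ℚ weight (blob X)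
  weight-blob-split X = subst (λ x → γ * x + (K - γ * toℚ v) ≤ℚ weight (blob X))
                              (trans (cong toℚ (∣members∣ (blob X))) (toℚ-+ _ _)) (weight-blob X)

  credit-full-blob : ∀ X → FullBlob (blob X) → K + γ * toℚ (outside (blob X)) ≤ℚ weight (blob X)
  credit-full-blob X full = begin
    K + γ * toℚ d
      ≡⟨ solve 4 (λ K γ v d → K :+ γ :* d := γ :* (v :+ d) :+ (K :- γ :* v)) refl K γ (toℚ v) (toℚ d) ⟩
    γ * (toℚ v + toℚ d) + (K - γ * toℚ v)
      ≡⟨ cong (λ w → γ * (toℚ w + toℚ d) + (K - γ * toℚ v)) (sym full) ⟩
    γ * (toℚ ∣ X ∘ φ ∣ + toℚ d) + (K - γ * toℚ v)
      ≤⟨ weight-blob-split X ⟩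
    weight (blob X) ∎
    where
      open ℚ.≤-Reasoning
      open +-*-Solver
      d = outside (blob X)

  -- The one use of γ: it bounds the edges of H meeting U, the vertices of the copy outside X.
  credit-partial-blob : ∀ X → Meets (blob X) → ¬ FullBlob (blob X) →
                        toℚ (spanned (blob X)) + γ * toℚ (outside (blob X)) ≤ℚ weight (blob X)
  credit-partial-blob X meets ¬full = begin
    toℚ m + γ * toℚ d
      ≡⟨ solve 4 (λ m γ d u → m :+ γ :* d := (m :+ γ :* d :- γ :* u) :+ γ :* u) refl (toℚ m) γ (toℚ d) (toℚ u) ⟩
    (toℚ m + γ * toℚ d - γ * toℚ u) + γ * toℚ u
      ≤⟨ ℚ.+-monoʳ-≤ (toℚ m + γ * toℚ d - γ * toℚ u) (ratio-bound H γ≤ratios U u>0 2≤v∸u) ⟩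
    (toℚ m + γ * toℚ d - γ * toℚ u) + (toℚ b - 1ℚ)
      ≡⟨ solve 6 (λ m γ d u b w → (m :+ γ :* d :- γ :* u) :+ (b :- con 1ℚ)
                                 := γ :* (w :+ d) :+ ((m :+ b) :- con 1ℚ :- γ :* (u :+ w)))
               refl (toℚ m) γ (toℚ d) (toℚ u) (toℚ b) (toℚ w) ⟩
    γ * (toℚ w + toℚ d) + ((toℚ m + toℚ b) - 1ℚ - γ * (toℚ u + toℚ w))
      ≡⟨ cong (λ k → γ * (toℚ w + toℚ d) + k) (sym K-γv≡) ⟩
    γ * (toℚ w + toℚ d) + (K - γ * toℚ v)
      ≤⟨ weight-blob-split X ⟩
    weight (blob X) ∎
    where
      open ℚ.≤-Reasoning
      open +-*-Solver
      S = X ∘ φ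
      U = not ∘ S
      m = spanned (blob X)
      d = outside (blob X)
      u = ∣ U ∣
      w = ∣ S ∣
      b = edgesMeeting H (toSubset U)
      u+w≡v : u ℕ.+ w ≡ v
      u+w≡v = ∣∁X∣+∣X∣≡n S
      u>0 : 0 < u
      u>0 = ℕ.n≢0⇒n>0 λ u≡0 → ¬full (trans (sym (cong (ℕ._+ w) u≡0)) u+w≡v)
      2≤v∸u : 2 ≤ v ∸ u
      2≤v∸u = subst (2 ≤_) (trans (sym (ℕ.m+n∸m≡n u w)) (cong (_∸ u) u+w≡v)) meets
      K-γv≡ : K - γ * toℚ v ≡ (toℚ m + toℚ b) - 1ℚ - γ * (toℚ u + toℚ w)
      K-γv≡ = trans (cong₂ (λ e x → toℚ e - 1ℚ - γ * toℚ x) (edgeCount-split H S) (sym u+w≡v))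
                    (cong₂ (λ e x → e - 1ℚ - γ * x) (toℚ-+ m b) (toℚ-+ u w))

  credit-bound : ∀ s → Meets s → credit s + γ * toℚ (outside s) ≤ℚ weight s
  credit-bound (edge p q) meets = credit-edge p q meets
  credit-bound (blob X) meets with fullBlob? (blob X)
  ... | yes full = subst (λ c → c + γ * toℚ (outside (blob X)) ≤ℚ weight (blob X))
                         (sym (credit-full {blob X} full)) (credit-full-blob X full)
  ... | no ¬full = subst (λ c → c + γ * toℚ (outside (blob X)) ≤ℚ weight (blob X))
                         (sym (credit-partial {blob X} ¬full)) (credit-partial-blob X meets ¬full)

  module _ (L : List (Cluster n)) where

    touching : List (Cluster n)
    touching = filter meets? L

    untouched : List (Cluster n)
    untouched = filter (¬? ∘ meets?) L

    merged : Fin n → Bool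
    merged i = image φ i ∨ any (λ s → members s i) touching

    merge : List (Cluster n)
    merge = blob merged ∷ untouched

    image⊆merged : ∀ a → merged (φ a) ≡ true
    image⊆merged a rewrite image-∋ φ a = refl

    touching⊆merged : ∀ {s} → s ∈ touching → ∀ {i} → members s i ≡ true → merged i ≡ true
    touching⊆merged s∈ {i} si = trans (cong (image φ i ∨_) touched) (∨-zeroʳ (image φ i))
      where
        touched : any (λ s → members s i) touching ≡ true
        touched = Equivalence.to T-≡ (any⁺ _ (lose s∈ (Equivalence.from T-≡ si)))

    merge-covers : ∀ {x y} → Covers L x y → Covers merge x y
    merge-covers {x} {y} (s , s∈L , sx , sy) with meets? s
    ... | yes meets = blob merged , here refl , touching⊆merged s∈ sx , touching⊆merged s∈ sy
      where s∈ = ∈-filter⁺ meets? s∈L meets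
    ... | no ¬meets = s , there (∈-filter⁺ (¬? ∘ meets?) s∈L ¬meets) , sx , sy

    ∣merged∣≤ : toℚ ∣ merged ∣ ≤ℚ toℚ v + ∑[ s ∈ touching ] toℚ (outside s)
    ∣merged∣≤ = begin
      toℚ ∣ merged ∣
        ≡⟨ cong toℚ (count-split (allFin n)) ⟩
      toℚ (on-image ℕ.+ off-image)
        ≡⟨ toℚ-+ on-image off-image ⟩
      toℚ on-image + toℚ off-image
        ≤⟨ ℚ.+-mono-≤ (toℚ-mono-≤ on-image≤v) (count≤∑ _ _ (allFin n) touching outside-covered) ⟩
      toℚ v + ∑[ s ∈ touching ] toℚ (outside s) ∎
      where
        open ℚ.≤-Reasoning
        on-image off-image : ℕ
        on-image  = ∣ (λ i → merged i ∧ image φ i) ∣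
        off-image = ∣ (λ i → merged i ∧ not (image φ i)) ∣
        on-image≤v : on-image ≤ v
        on-image≤v = ℕ.≤-trans (count-mono (λ i → proj₂ ∘ ∧-true⁻ {merged i}) (allFin n))
                               (ℕ.≤-reflexive (∣image∣ φ-inj))
        outside-covered : ∀ i → i ∈ allFin n → merged i ∧ not (image φ i) ≡ true →
                          ∃[ s ] (s ∈ touching × members s i ∧ not (image φ i) ≡ true)
        outside-covered i _ i∈ with ∧-true⁻ {merged i} i∈
        ... | i∈merged , i∉image
          with find (any⁻ _ touching (Equivalence.from T-≡ (∨-resolve i∈merged i∉image)))
        ...   | s , s∈ , si = s , s∈ , cong₂ _∧_ (Equivalence.to T-≡ si) i∉image

    -- The copy may use one edge pq not covered by L: the edge just added.
    module _ {p q : Fin n} (covered : ∀ a b → adj H a b ≡ true → Covers (edge p q ∷ L) (φ a) (φ b)) where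

      edgeCount≤ : toℚ (edgeCount H) ≤ℚ 1ℚ + ∑[ s ∈ touching ] toℚ (spanned s)
      edgeCount≤ = ℚ.≤-trans
        (count≤∑ _ (λ s → edgeWithin H (members s ∘ φ)) (pairs v) (edge p q ∷ touching) edge-covered)
        (ℚ.+-monoˡ-≤ (∑[ s ∈ touching ] toℚ (spanned s)) (spanned-edge≤1 p q))
        where
          edge-covered : ∀ ab → ab ∈ pairs v → adj H (proj₁ ab) (proj₂ ab) ≡ true →
                         ∃[ s ] (s ∈ edge p q ∷ touching × edgeWithin H (members s ∘ φ) ab ≡ true)
          edge-covered (a , b) ab∈ ab-edge with covered a b ab-edge
          ... | s , here refl , sa , sb = s , here refl , ∧³-true ab-edge sa sb
          ... | s , there s∈L , sa , sb = s , there (∈-filter⁺ meets? s∈L meets) , ∧³-true ab-edge sa sb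
            where meets = ∈⇒count≥2 (∈-allFin a) (∈-allFin b) (∈-pairs⇒≢ ab∈) sa sb

      K≤∑credit : K ≤ℚ ∑[ s ∈ touching ] credit s
      K≤∑credit with Any.any? fullBlob? touching
      ... | yes someFull with find someFull
      ...   | s , s∈ , full =
              subst (_≤ℚ ∑[ s ∈ touching ] credit s) (credit-full {s} full) (∈⇒≤∑ (λ s _ → 0≤credit s) s∈)
      K≤∑credit | no noneFull = begin
        toℚ (edgeCount H) - 1ℚ
          ≤⟨ ℚ.+-monoˡ-≤ (ℚ.- 1ℚ) edgeCount≤ ⟩
        1ℚ + ∑[ s ∈ touching ] toℚ (spanned s) - 1ℚ
          ≡⟨ solve 1 (λ x → con 1ℚ :+ x :- con 1ℚ := x) refl (∑[ s ∈ touching ] toℚ (spanned s)) ⟩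
        ∑[ s ∈ touching ] toℚ (spanned s)
          ≡⟨ ∑-cong touching (λ s s∈ → sym (credit-partial {s} (noneFull ∘ lose s∈))) ⟩
        ∑[ s ∈ touching ] credit s ∎
        where
          open ℚ.≤-Reasoning
          open +-*-Solver

      merge-cheaper : cost merge ≤ℚ cost L
      merge-cheaper = begin
        weight (blob merged) + cost untouched
          ≤⟨ ℚ.+-monoˡ-≤ (cost untouched) (ℚ.⊔-lub merged-bound (0≤∑ touching (λ s _ → 0≤weight s))) ⟩
        cost touching + cost untouched
          ≡⟨ sym (∑-partition meets? L) ⟩
        cost L ∎
        where
          open ℚ.≤-Reasoning
          D = ∑[ s ∈ touching ] toℚ (outside s)
          merged-bound : γ * toℚ ∣ merged ∣ + (K - γ * toℚ v) ≤ℚ cost touching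
          merged-bound = begin
            γ * toℚ ∣ merged ∣ + (K - γ * toℚ v)
              ≤⟨ ℚ.+-monoˡ-≤ (K - γ * toℚ v) (ℚ.*-monoˡ-≤-nonNeg γ {{ℚ.nonNegative 0≤γ}} ∣merged∣≤) ⟩
            γ * (toℚ v + D) + (K - γ * toℚ v)
              ≡⟨ solve 4 (λ γ v D K → γ :* (v :+ D) :+ (K :- γ :* v) := K :+ γ :* D) refl γ (toℚ v) D K ⟩
            K + γ * D
              ≤⟨ ℚ.+-monoˡ-≤ (γ * D) K≤∑credit ⟩
            ∑[ s ∈ touching ] credit s + γ * D
              ≡⟨ cong (_+_ (∑[ s ∈ touching ] credit s)) (sym (∑-*ˡ γ touching)) ⟩
            ∑[ s ∈ touching ] credit s + ∑[ s ∈ touching ] (γ * toℚ (outside s))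
              ≡⟨ sym (∑-+ touching) ⟩
            ∑[ s ∈ touching ] (credit s + γ * toℚ (outside s))
              ≤⟨ ∑-mono-≤ touching (λ s s∈ → credit-bound s (proj₂ (∈-filter⁻ meets? {xs = L} s∈))) ⟩
            cost touching ∎
            where open +-*-Solver

-- A weakly saturated graph yields a cover of all pairs of weight at most e(F)

module Saturation (H : Graph v) (γ : ℚ) (0≤γ : 0ℚ ≤ℚ γ) (0≤K : 0ℚ ≤ℚ Weight.K H γ)
                  (γ≤ratios : LowerBoundsRatios H γ) (F : Graph n) where

  open Weight H γ

  record CheapCover (es : List (Fin n × Fin n)) : Set where
    field
      clusters : List (Cluster n)
      cheap    : cost clusters ≤ℚ toℚ (edgeCount F)
      covers   : ∀ {x y} → AdjPlus F es x y → Covers clusters x y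
  open CheapCover

  edgeClusters : List (Fin n × Fin n) → List (Cluster n)
  edgeClusters []              = []
  edgeClusters ((i , j) ∷ ijs) = if adj F i j then edge i j ∷ edgeClusters ijs else edgeClusters ijs

  cost-edgeClusters : ∀ ijs → cost (edgeClusters ijs) ≡ toℚ (count (λ ij → adj F (proj₁ ij) (proj₂ ij)) ijs)
  cost-edgeClusters []              = sym toℚ-0
  cost-edgeClusters ((i , j) ∷ ijs) with adj F i j
  ... | true  = trans (cong₂ _+_ (sym toℚ-1) (cost-edgeClusters ijs)) (sym (toℚ-+ 1 _))
  ... | false = cost-edgeClusters ijs

  ∈-edgeClusters : ∀ {i j ijs} → (i , j) ∈ ijs → adj F i j ≡ true → edge i j ∈ edgeClusters ijs
  ∈-edgeClusters {i} {j} (here refl) ij with adj F i j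
  ... | true = here refl
  ∈-edgeClusters {ijs = (k , l) ∷ _} (there ij∈) ij with adj F k l
  ... | true  = there (∈-edgeClusters ij∈ ij)
  ... | false = ∈-edgeClusters ij∈ ij

  initial : CheapCover []
  initial = record
    { clusters = edgeClusters (pairs n)
    ; cheap    = ℚ.≤-reflexive (cost-edgeClusters (pairs n))
    ; covers   = λ { (inj₁ xy) → covers-edge xy ; (inj₂ (inj₁ ())) ; (inj₂ (inj₂ ())) }
    }
    where
      covers-edge : ∀ {x y} → adj F x y ≡ true → Covers (edgeClusters (pairs n)) x y
      covers-edge {x} {y} xy with ∈-pairs-either (adj⇒≢ F xy)
      ... | inj₁ xy∈ = edge x y , ∈-edgeClusters xy∈ xy , ⁅,⁆-∋ˡ x y , ⁅,⁆-∋ʳ x y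
      ... | inj₂ yx∈ = edge y x , ∈-edgeClusters yx∈ (trans (Graph.sym F y x) xy) , ⁅,⁆-∋ʳ y x , ⁅,⁆-∋ˡ y x

  AdjPlus-∷ʳ⁻ : ∀ {es e x y} → AdjPlus F (es ∷ʳ e) x y → AdjPlus F es x y ⊎ ((x , y) ≡ e ⊎ (y , x) ≡ e)
  AdjPlus-∷ʳ⁻ (inj₁ xy) = inj₁ (inj₁ xy)
  AdjPlus-∷ʳ⁻ {es} (inj₂ (inj₁ xy∈)) with ∈-++⁻ es xy∈
  ... | inj₁ xy∈es      = inj₁ (inj₂ (inj₁ xy∈es))
  ... | inj₂ (here xy≡) = inj₂ (inj₁ xy≡)
  AdjPlus-∷ʳ⁻ {es} (inj₂ (inj₂ yx∈)) with ∈-++⁻ es yx∈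
  ... | inj₁ yx∈es      = inj₁ (inj₂ (inj₂ yx∈es))
  ... | inj₂ (here yx≡) = inj₂ (inj₂ yx≡)

  extend : ∀ {es p q} → CheapCover es → CopyContaining H F (es ∷ʳ (p , q)) (p , q) → CheapCover (es ∷ʳ (p , q))
  extend {es} {p} {q} C (φ , φ-inj , copy , x₀ , y₀ , _ , φx₀≡p , φy₀≡q) = record
    { clusters = merge (clusters C)
    ; cheap    = ℚ.≤-trans (merge-cheaper (clusters C) covered) (cheap C)
    ; covers   = covers′
    }
    where
      open Merge H γ 0≤γ 0≤K γ≤ratios φ-inj
      covered : ∀ a b → adj H a b ≡ true → Covers (edge p q ∷ clusters C) (φ a) (φ b)
      covered a b ab with AdjPlus-∷ʳ⁻ (copy a b ab)
      ... | inj₁ old = Covers-∷ (covers C old)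
      ... | inj₂ new = edge p q , here refl , endpoints∈⁅,⁆ new
      ⁅p,q⁆⊆merged : ∀ {i} → ⁅ p , q ⁆ i ≡ true → merged (clusters C) i ≡ true
      ⁅p,q⁆⊆merged {i} i∈ with ⁅,⁆⁻ {p = p} {q} {i} i∈
      ... | inj₁ refl = subst (λ i → merged (clusters C) i ≡ true) φx₀≡p (image⊆merged (clusters C) x₀)
      ... | inj₂ refl = subst (λ i → merged (clusters C) i ≡ true) φy₀≡q (image⊆merged (clusters C) y₀)
      covers′ : ∀ {x y} → AdjPlus F (es ∷ʳ (p , q)) x y → Covers (merge (clusters C)) x y
      covers′ xy with AdjPlus-∷ʳ⁻ xy
      ... | inj₁ old = merge-covers (clusters C) (covers C old)
      ... | inj₂ new =
            blob (merged (clusters C)) , here refl , Product.map ⁅p,q⁆⊆merged ⁅p,q⁆⊆merged (endpoints∈⁅,⁆ new)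

  module _ {es : List (Fin n × Fin n)}
           (copies : ∀ (k : Fin (length es)) → CopyContaining H F (take (suc (toℕ k)) es) (lookup es k)) where

    cheap-prefix : ∀ t → t ≤ length es → CheapCover (take t es)
    cheap-prefix zero    _     = initial
    cheap-prefix (suc t) t<len = subst (λ m → CheapCover (take (suc m) es)) (toℕ-fromℕ< t<len) next
      where
        k = Fin.fromℕ< t<len
        previous : CheapCover (take (toℕ k) es)
        previous = subst (λ m → CheapCover (take m es)) (sym (toℕ-fromℕ< t<len)) (cheap-prefix t (ℕ.<⇒≤ t<len))
        next : CheapCover (take (suc (toℕ k)) es)
        next rewrite take-suc es k =
          extend previous (subst (λ pre → CopyContaining H F pre (lookup es k)) (take-suc es k) (copies k))

  cheap-cover-of-all-pairs : WeaklySaturated H F →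
                             ∃[ L ] (cost L ≤ℚ toℚ (edgeCount F) × CoversAllPairs L)
  cheap-cover-of-all-pairs (es , (_ , _ , enumerates) , copies) =
    clusters final , cheap final , covers-all
    where
      final : CheapCover es
      final = subst CheapCover (take-all (length es) es ℕ.≤-refl) (cheap-prefix copies (length es) ℕ.≤-refl)
      covers-all : CoversAllPairs (clusters final)
      covers-all {x} {y} x≢y with ∈-pairs-either x≢y
      ... | inj₁ xy∈ with adj F x y in xy
      ...   | true  = covers final (inj₁ xy)
      ...   | false = covers final (inj₂ (inj₁ (enumerates xy∈ xy)))
      covers-all {x} {y} x≢y | inj₂ yx∈ with adj F y x in yx
      ...   | true  = covers final (inj₁ (trans (Graph.sym F x y) yx))
      ...   | false = covers final (inj₂ (inj₂ (enumerates yx∈ yx)))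

-- A cover of all pairs weighs at least γ(n − v) + e(H) − 1

module Absorption (H : Graph v) (γ : ℚ) (0≤γ : 0ℚ ≤ℚ γ) (0≤K : 0ℚ ≤ℚ Weight.K H γ)
                  (γ≤ratios : LowerBoundsRatios H γ) (3≤v : 3 ≤ v) (v≤n : v ≤ n) where

  open Weight H γ

  φ₀ : Fin v → Fin n
  φ₀ a = Fin.inject≤ a v≤n

  φ₀-inj : Injective _≡_ _≡_ φ₀
  φ₀-inj {a} {b} = inject≤-injective v≤n v≤n a b

  z₀ a₁ a₂ : Fin v
  z₀ = Fin.inject≤ zero 3≤v
  a₁ = Fin.inject≤ (suc zero) 3≤v
  a₂ = Fin.inject≤ (suc (suc zero)) 3≤v

  inject≤-≢ : ∀ {i j : Fin 3} → i ≢ j → Fin.inject≤ i 3≤v ≢ Fin.inject≤ j 3≤v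
  inject≤-≢ i≢j = i≢j ∘ inject≤-injective 3≤v 3≤v _ _

  a₁≢z₀ : a₁ ≢ z₀
  a₁≢z₀ = inject≤-≢ λ ()

  a₂≢z₀ : a₂ ≢ z₀
  a₂≢z₀ = inject≤-≢ λ ()

  a₁≢a₂ : a₁ ≢ a₂
  a₁≢a₂ = inject≤-≢ λ ()

  module Along {ψ : Fin v → Fin n} (ψ-inj : Injective _≡_ _≡_ ψ)
               {L : List (Cluster n)} (all : CoversAllPairs L) where

    open Merge H γ 0≤γ 0≤K γ≤ratios ψ-inj public

    -- L covers every pair.
    merge-cheaper-all : cost (merge L) ≤ℚ cost L
    merge-cheaper-all = merge-cheaper L {ψ z₀} {ψ z₀} (λ a b ab → Covers-∷ (all (adj⇒≢ H ab ∘ ψ-inj)))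

    merge-covers-all : CoversAllPairs (merge L)
    merge-covers-all x≢y = merge-covers L (all x≢y)

  record Absorbing (bound : ℚ) (xs : List (Fin n)) : Set where
    field
      clusters  : List (Cluster n)
      cheap     : cost clusters ≤ℚ bound
      covers    : CoversAllPairs clusters
      core      : Fin n → Bool
      core∈     : blob core ∈ clusters
      base⊆core : ∀ a → core (φ₀ a) ≡ true
      xs⊆core   : ∀ {x} → x ∈ xs → core x ≡ true
  open Absorbing

  absorbing-base : ∀ L → CoversAllPairs L → Absorbing (cost L) []
  absorbing-base L all = record
    { clusters  = merge L
    ; cheap     = merge-cheaper-all
    ; covers    = merge-covers-all
    ; core      = merged L
    ; core∈     = here refl
    ; base⊆core = image⊆merged L
    ; xs⊆core   = λ ()
    }
    where open Along φ₀-inj all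

  absorb : ∀ {bound xs} x → Absorbing bound xs → Absorbing bound (x ∷ xs)
  absorb x st with core st x in x-in-core
  ... | true  = record
    { clusters  = clusters st
    ; cheap     = cheap st
    ; covers    = covers st
    ; core      = core st
    ; core∈     = core∈ st
    ; base⊆core = base⊆core st
    ; xs⊆core   = λ { (here refl) → x-in-core ; (there y∈) → xs⊆core st y∈ }
    }
  ... | false = record
    { clusters  = merge (clusters st)
    ; cheap     = ℚ.≤-trans merge-cheaper-all (cheap st)
    ; covers    = merge-covers-all
    ; core      = merged (clusters st)
    ; core∈     = here refl
    ; base⊆core = λ a → core⊆merged (base⊆core st a)
    ; xs⊆core   = λ { (here refl) → x∈merged ; (there y∈) → core⊆merged (xs⊆core st y∈) }
    }
    where
      -- φ₀ with z₀ redirected to x meets the core in a₁ and a₂, so merging along it swallows the core and x.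
      ψ = update φ₀ z₀ x
      ψ-inj = update-injective φ₀-inj z₀ λ a φ₀a≡x →
        contradiction (trans (sym x-in-core) (trans (sym (cong (core st) φ₀a≡x)) (base⊆core st a))) λ ()
      open Along ψ-inj (covers st)
      ψ-in-core : ∀ {a} → a ≢ z₀ → core st (ψ a) ≡ true
      ψ-in-core {a} a≢z₀ = trans (cong (core st) (update-else φ₀ x a≢z₀)) (base⊆core st a)
      core-touching : blob (core st) ∈ touching (clusters st)
      core-touching = ∈-filter⁺ meets? (core∈ st)
        (∈⇒count≥2 (∈-allFin a₁) (∈-allFin a₂) a₁≢a₂ (ψ-in-core a₁≢z₀) (ψ-in-core a₂≢z₀))
      core⊆merged : ∀ {i} → core st i ≡ true → merged (clusters st) i ≡ true
      core⊆merged = touching⊆merged (clusters st) core-touching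
      x∈merged : merged (clusters st) x ≡ true
      x∈merged = subst (λ i → merged (clusters st) i ≡ true) (update-at φ₀ z₀ x)
                       (image⊆merged (clusters st) z₀)

  absorb-all : ∀ {bound} xs → Absorbing bound [] → Absorbing bound xs
  absorb-all []       st = st
  absorb-all (x ∷ xs) st = absorb x (absorb-all xs st)

  cost-of-cover : ∀ L → CoversAllPairs L → γ * toℚ (n ∸ v) + K ≤ℚ cost L
  cost-of-cover L all = begin
    γ * toℚ (n ∸ v) + K
      ≡⟨ solve 4 (λ γ m v K → γ :* m :+ K := γ :* (m :+ v) :+ (K :- γ :* v)) refl γ (toℚ (n ∸ v)) (toℚ v) K ⟩
    γ * (toℚ (n ∸ v) + toℚ v) + (K - γ * toℚ v)
      ≡⟨ cong (λ m → γ * m + (K - γ * toℚ v)) (sym (toℚ-+ (n ∸ v) v)) ⟩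
    γ * toℚ (n ∸ v ℕ.+ v) + (K - γ * toℚ v)
      ≡⟨ cong (λ m → γ * toℚ m + (K - γ * toℚ v)) (trans (ℕ.m∸n+n≡m v≤n) (sym ∣core∣≡n)) ⟩
    γ * toℚ ∣ core st ∣ + (K - γ * toℚ v)
      ≤⟨ weight-blob (core st) ⟩
    weight (blob (core st))
      ≤⟨ ∈⇒≤∑ (λ s _ → 0≤weight s) (core∈ st) ⟩
    cost (clusters st)
      ≤⟨ cheap st ⟩
    cost L ∎
    where
      open ℚ.≤-Reasoning
      open +-*-Solver
      st = absorb-all (allFin n) (absorbing-base L all)
      ∣core∣≡n : ∣ core st ∣ ≡ n
      ∣core∣≡n = ∣all∣≡n (λ x → xs⊆core st (∈-allFin x))

wsat-lower-bound : (H : Graph v) (γ : ℚ) → 0ℚ ≤ℚ γ → LowerBoundsRatios H γ → 0 < edgeCount H → 3 ≤ v →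
                   ∀ n → v ≤ n → (F : Graph n) → WeaklySaturated H F →
                   γ * toℚ (n ∸ v) + (toℚ (edgeCount H) - 1ℚ) ≤ℚ toℚ (edgeCount F)
wsat-lower-bound H γ 0≤γ γ≤ratios e>0 3≤v n v≤n F saturated =
  let L , cheap , covers-all = cheap-cover-of-all-pairs saturated
  in  ℚ.≤-trans (cost-of-cover L covers-all) cheap
  where
    0≤K = Weight.edgeCount>0⇒0≤K H γ e>0
    open Saturation H γ 0≤γ 0≤K γ≤ratios F
    open Absorption H γ 0≤γ 0≤K γ≤ratios 3≤v v≤n

corollary5p6 : ∀ {v : ℕ} (H : Graph v) → MinDegree≥ H 2 →
    ∀ (n : ℕ) → v ≤ n → ∀ (F : Graph n) → WeaklySaturated H F →
    γ H 2 * (+ (n ∸ v) / 1) + ((+ edgeCount H / 1) - (+ 1 / 1)) ≤ℚ (+ edgeCount F / 1)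
corollary5p6 {zero} H _ n _ F _ = begin
  -- With no vertices there is no admissible set, so γ H 2 is minList [] = 0ℚ.
  0ℚ * (+ n / 1) + (0ℚ - 1ℚ)  ≡⟨ cong (_+ (0ℚ - 1ℚ)) (ℚ.*-zeroˡ (+ n / 1)) ⟩
  0ℚ - 1ℚ                     ≤⟨ ℚ.nonPositive⁻¹ _ ⟩
  0ℚ                          ≤⟨ 0≤toℚ (edgeCount F) ⟩
  toℚ (edgeCount F)           ≡⟨ toℚ-/1 (edgeCount F) ⟩
  + edgeCount F / 1           ∎
  where open ℚ.≤-Reasoning
corollary5p6 {suc v} H δ≥2 n v≤n F saturated =
  subst₂ _≤ℚ_ (cong₂ (λ m e → γ H 2 * m + (e - 1ℚ)) (toℚ-/1 (n ∸ suc v)) (toℚ-/1 (edgeCount H)))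
              (toℚ-/1 (edgeCount F))
              (wsat-lower-bound H (γ H 2) (0≤γ H deg>0) (γ-lowerBoundsRatios H) (edgeCount>0 H (deg>0 zero)) 3≤v
                                n v≤n F saturated)
  where
    deg>0 : ∀ a → 0 < degree H a
    deg>0 a = ℕ.≤-trans (s≤s z≤n) (δ≥2 a)
    3≤v : 3 ≤ suc v
    3≤v = ℕ.≤-trans (s≤s (δ≥2 zero)) (degree<v H zero)
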